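{- Let $a$ be an even integer and $b,q$ odd positive integers, and let $p\in\mathbb{N}_0$. Then $T_p(qa,qb)=q^{ -1}T_p(a,b)$, where for integers $a$ and positive integers $b$, $$T_p(a,b)=2\sum_{j=0}^{b-1}(-1)^j\,\overline{E}_p\!\left(\frac{aj}{b}\right)\overline{E}_1\!\left(\frac{j}{b}\right).$$
   Context: The Euler polynomials $E_k(x)$, $k\in\mathbb{N}_0$, are defined by $\frac{2e^{xt}}{e^t+1}=\sum_{k=0}^\infty E_k(x)\frac{t^k}{k!}$. The quasi-periodic Euler function is $\overline{E}_k(x)=(-1)^{[x]}E_k(\{x\})$ for real $x$, where $[x]$ is the greatest integer not exceeding $x$ and $\{x\}=x-[x]$. -}

module Defs where

open import Data.Nat as ℕ using (ℕ; zero; suc; NonZero)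
open import Data.Nat.DivMod using (_%_)
open import Data.Nat.Combinatorics using (_C_)
open import Data.Integer as ℤ using (ℤ; +_)
open import Data.Rational as ℚ using (ℚ; 0ℚ; 1ℚ; ½; floor; _/_)
open import Data.List using (List; []; _∷_; _++_; [_]; foldr; zip; upTo; map; last)
open import Data.Product using (_,_)
open import Data.Maybe using (just; nothing)

_^ℚ_ : ℚ → ℕ → ℚ
x ^ℚ zero  = 1ℚ
x ^ℚ suc n = x ℚ.* (x ^ℚ n)

sumℚ : List ℚ → ℚ
sumℚ = foldr ℚ._+_ 0ℚ

-- Comparing coefficients of t^n/n! in
--   (e^t + 1) * Σ E_k(x) t^k/k! = 2 e^{xt}
-- gives  Σ_{j=0}^{n} C(n,j) E_j(x) + E_n(x) = 2 x^n, i.e.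
--   E_n(x) = x^n - ½ Σ_{j<n} C(n,j) E_j(x).
-- eulerStep n x l computes E_n(x) from l = [E_0(x), …, E_{n-1}(x)].
eulerStep : ℕ → ℚ → List ℚ → ℚ
eulerStep n x l =
  (x ^ℚ n) ℚ.- ½ ℚ.* sumℚ (map (λ { (j , e) → ((+ (n C j)) / 1) ℚ.* e }) (zip (upTo n) l))

eulerList : ℕ → ℚ → List ℚ
eulerList zero    x = []
eulerList (suc n) x = eulerList n x ++ [ eulerStep n x (eulerList n x) ]

E : ℕ → ℚ → ℚ
E k x = eulerStep k x (eulerList k x)

negOnePow : ℤ → ℚ
negOnePow z with ℤ.∣ z ∣ % 2
... | zero = 1ℚ
... | suc _ = ℚ.- 1ℚ

frac : ℚ → ℚ
frac x = x ℚ.- (floor x / 1)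

Ebar : ℕ → ℚ → ℚ
Ebar k x = negOnePow (floor x) ℚ.* E k (frac x)

T : ℕ → ℤ → (b : ℕ) → .{{_ : NonZero b}} → ℚ
T p a b = (+ 2 / 1) ℚ.* sumℚ (map term (upTo b))
  where
  term : ℕ → ℚ
  term j = negOnePow (+ j) ℚ.* Ebar p ((a ℤ.* + j) / b) ℚ.* Ebar 1 ((+ j) / b)

-- Write j < q b as j = m b + i with m < q and i < b.  Since a is even, the argument
-- q a j / (q b) = a i / b + a m differs from a i / b by an even integer, and Ē_p has
-- period 2; since b is odd, (-1)^j = (-1)^m (-1)^i.  The sum over the q lifts of a
-- fixed i therefore only involves Σ_m (-1)^m Ē_1((m b + i)/(q b)), an alternating sum
-- of an arithmetic progression, which for odd q equals q⁻¹ Ē_1(i / b).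
module Submission where

open import Defs
open import Data.Nat using (ℕ; zero; suc; NonZero)
import Data.Nat as ℕ
import Data.Nat.Properties as ℕP
open import Data.Nat.Properties using (m*n≢0)
open import Data.Nat.Divisibility as ND using (divides)
import Data.Nat.GCD as ℕGCD
open import Data.Integer as ℤ using (ℤ; +_; -[1+_])
import Data.Integer.Properties as ℤP
import Data.Integer.DivMod as ℤD
import Data.Integer.GCD as ℤGCD
open import Data.Integer.Divisibility as ZD using ()
open import Data.Integer.Divisibility.Signed using (∣ᵤ⇒∣; divides)
open import Data.Rational as ℚ using (ℚ; mkℚ; ↥_; ↧_; floor; _/_; 0ℚ; 1ℚ; ½)
import Data.Rational.Properties as ℚP
import Data.Rational.Unnormalised as ℚᵘ
import Data.Rational.Unnormalised.Properties as ℚᵘP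
open import Data.List using (map; applyUpTo)
open import Data.Product using (∃; _,_)
open import Data.Sum using (inj₂)
open import Data.Empty using (⊥-elim)
open import Function using (id; _∘_)
open import Level using (0ℓ)
open import Relation.Nullary using (¬_)
open import Relation.Nullary.Decidable.Core using (dec⇒maybe)
open import Relation.Binary.PropositionalEquality
open import Tactic.RingSolver using (solve-∀)
open import Tactic.RingSolver.Core.AlmostCommutativeRing using (AlmostCommutativeRing; fromCommutativeRing)
import Data.Nat.Tactic.RingSolver as ℕ-Solver
import Data.Integer.Tactic.RingSolver as ℤ-Solver

ℚ-ring : AlmostCommutativeRing 0ℓ 0ℓ
ℚ-ring = fromCommutativeRing ℚP.+-*-commutativeRing (λ x → dec⇒maybe (0ℚ ℚP.≟ x))

∑< : ℕ → (ℕ → ℚ) → ℚ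
∑< zero    f = 0ℚ
∑< (suc n) f = f 0 ℚ.+ ∑< n (λ k → f (suc k))

syntax ∑< n (λ i → x) = ∑[ i < n ] x

sumℚ-map-applyUpTo : ∀ (f : ℕ → ℚ) g n → sumℚ (map f (applyUpTo g n)) ≡ ∑[ k < n ] f (g k)
sumℚ-map-applyUpTo f g zero    = refl
sumℚ-map-applyUpTo f g (suc n) = cong (f (g 0) ℚ.+_) (sumℚ-map-applyUpTo f (λ k → g (suc k)) n)

∑-cong : ∀ n {f g : ℕ → ℚ} → (∀ k → k ℕ.< n → f k ≡ g k) → ∑< n f ≡ ∑< n g
∑-cong zero    f≡g = refl
∑-cong (suc n) f≡g = cong₂ ℚ._+_ (f≡g 0 (ℕ.s≤s ℕ.z≤n)) (∑-cong n (λ k k<n → f≡g (suc k) (ℕ.s≤s k<n)))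

∑-zero : ∀ n → ∑[ k < n ] 0ℚ ≡ 0ℚ
∑-zero zero    = refl
∑-zero (suc n) = cong (0ℚ ℚ.+_) (∑-zero n)

∑-distribˡ : ∀ n c f → ∑[ k < n ] (c ℚ.* f k) ≡ c ℚ.* ∑< n f
∑-distribˡ zero    c f = sym (ℚP.*-zeroʳ c)
∑-distribˡ (suc n) c f = trans (cong (c ℚ.* f 0 ℚ.+_) (∑-distribˡ n c (λ k → f (suc k))))
                               (sym (ℚP.*-distribˡ-+ c (f 0) _))

∑-distrib-+ : ∀ n f g → ∑[ k < n ] (f k ℚ.+ g k) ≡ ∑< n f ℚ.+ ∑< n g
∑-distrib-+ zero    f g = refl
∑-distrib-+ (suc n) f g =
  trans (cong (f 0 ℚ.+ g 0 ℚ.+_) (∑-distrib-+ n (λ k → f (suc k)) (λ k → g (suc k))))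
        (interchange (f 0) (g 0) _ _)
  where
  interchange : ∀ a b c d → (a ℚ.+ b) ℚ.+ (c ℚ.+ d) ≡ (a ℚ.+ c) ℚ.+ (b ℚ.+ d)
  interchange = solve-∀ ℚ-ring

∑-+ : ∀ m n f → ∑< (m ℕ.+ n) f ≡ ∑< m f ℚ.+ ∑[ k < n ] f (m ℕ.+ k)
∑-+ zero    n f = sym (ℚP.+-identityˡ _)
∑-+ (suc m) n f = trans (cong (f 0 ℚ.+_) (∑-+ m n (λ k → f (suc k))))
                        (sym (ℚP.+-assoc (f 0) _ _))

∑-* : ∀ q b f → ∑< (q ℕ.* b) f ≡ ∑[ m < q ] ∑[ i < b ] f (m ℕ.* b ℕ.+ i)
∑-* zero    b f = refl
∑-* (suc q) b f = begin
  ∑< (b ℕ.+ q ℕ.* b) f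
    ≡⟨ ∑-+ b (q ℕ.* b) f ⟩
  ∑< b f ℚ.+ ∑[ k < q ℕ.* b ] f (b ℕ.+ k)
    ≡⟨ cong (∑< b f ℚ.+_) (∑-* q b (λ k → f (b ℕ.+ k))) ⟩
  ∑< b f ℚ.+ ∑[ m < q ] ∑[ i < b ] f (b ℕ.+ (m ℕ.* b ℕ.+ i))
    ≡⟨ cong (∑< b f ℚ.+_) (∑-cong q (λ m _ → ∑-cong b (λ i _ → cong f (sym (ℕP.+-assoc b (m ℕ.* b) i))))) ⟩
  ∑< b f ℚ.+ ∑[ m < q ] ∑[ i < b ] f (b ℕ.+ m ℕ.* b ℕ.+ i) ∎
  where open ≡-Reasoning

∑-comm : ∀ q b (f : ℕ → ℕ → ℚ) → ∑[ m < q ] ∑[ i < b ] f m i ≡ ∑[ i < b ] ∑[ m < q ] f m i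
∑-comm zero    b f = sym (∑-zero b)
∑-comm (suc q) b f = trans (cong (∑< b (f 0) ℚ.+_) (∑-comm q b (λ m → f (suc m))))
                           (sym (∑-distrib-+ b (f 0) (λ i → ∑[ m < q ] f (suc m) i)))

/-cross : ∀ z w m n .{{_ : NonZero m}} .{{_ : NonZero n}} → z ℤ.* + n ≡ w ℤ.* + m → z / m ≡ w / n
/-cross z w (suc m) (suc n) eq = ℚP.fromℚᵘ-cong {ℚᵘ.mkℚᵘ z m} {ℚᵘ.mkℚᵘ w n} (ℚᵘ.*≡* eq)

/-crossℕ : ∀ a b m n .{{_ : NonZero m}} .{{_ : NonZero n}} → a ℕ.* n ≡ b ℕ.* m → + a / m ≡ + b / n
/-crossℕ a b m n eq = /-cross (+ a) (+ b) m n (begin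
  + a ℤ.* + n    ≡⟨ ℤP.pos-* a n ⟨
  + (a ℕ.* n)    ≡⟨ cong +_ eq ⟩
  + (b ℕ.* m)    ≡⟨ ℤP.pos-* b m ⟩
  + b ℤ.* + m    ∎)
  where open ≡-Reasoning

/-+-/ : ∀ z w m n → z / suc m ℚ.+ w / suc n ≡ (z ℤ.* + suc n ℤ.+ w ℤ.* + suc m) / (suc m ℕ.* suc n)
/-+-/ z w m n = ℚP.toℚᵘ-injective (begin
  ℚ.toℚᵘ (z / suc m ℚ.+ w / suc n)
    ≈⟨ ℚP.toℚᵘ-homo-+ (z / suc m) (w / suc n) ⟩
  ℚ.toℚᵘ (z / suc m) ℚᵘ.+ ℚ.toℚᵘ (w / suc n)
    ≈⟨ ℚᵘP.+-cong (ℚP.toℚᵘ-fromℚᵘ (ℚᵘ.mkℚᵘ z m)) (ℚP.toℚᵘ-fromℚᵘ (ℚᵘ.mkℚᵘ w n)) ⟩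
  ℚᵘ.mkℚᵘ z m ℚᵘ.+ ℚᵘ.mkℚᵘ w n
    ≈⟨ ℚᵘP.≃-sym (ℚP.toℚᵘ-fromℚᵘ _) ⟩
  ℚ.toℚᵘ ((z ℤ.* + suc n ℤ.+ w ℤ.* + suc m) / (suc m ℕ.* suc n)) ∎)
  where open ℚᵘP.≃-Reasoning

/-*-/ : ∀ a b m n → + a / suc m ℚ.* (+ b / suc n) ≡ + (a ℕ.* b) / (suc m ℕ.* suc n)
/-*-/ a b m n = ℚP.toℚᵘ-injective (begin
  ℚ.toℚᵘ (+ a / suc m ℚ.* (+ b / suc n))
    ≈⟨ ℚP.toℚᵘ-homo-* (+ a / suc m) (+ b / suc n) ⟩
  ℚ.toℚᵘ (+ a / suc m) ℚᵘ.* ℚ.toℚᵘ (+ b / suc n)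
    ≈⟨ ℚᵘP.*-cong (ℚP.toℚᵘ-fromℚᵘ (ℚᵘ.mkℚᵘ (+ a) m)) (ℚP.toℚᵘ-fromℚᵘ (ℚᵘ.mkℚᵘ (+ b) n)) ⟩
  ℚᵘ.mkℚᵘ (+ a) m ℚᵘ.* ℚᵘ.mkℚᵘ (+ b) n
    ≈⟨ ℚᵘP.≃-reflexive (cong (λ z → z ℚᵘ./ (suc m ℕ.* suc n)) (sym (ℤP.pos-* a b))) ⟩
  + (a ℕ.* b) ℚᵘ./ (suc m ℕ.* suc n)
    ≈⟨ ℚᵘP.≃-sym (ℚP.toℚᵘ-fromℚᵘ (+ (a ℕ.* b) ℚᵘ./ (suc m ℕ.* suc n))) ⟩
  ℚ.toℚᵘ (+ (a ℕ.* b) / (suc m ℕ.* suc n)) ∎)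
  where open ℚᵘP.≃-Reasoning

+-distrib-/ : ∀ z w n .{{_ : NonZero n}} → (z ℤ.+ w) / n ≡ z / n ℚ.+ w / n
+-distrib-/ z w n@(suc n-1) = sym (trans (/-+-/ z w n-1 n-1)
  (/-cross (z ℤ.* + n ℤ.+ w ℤ.* + n) (z ℤ.+ w) (n ℕ.* n) n
    (trans (factor z w (+ n)) (cong (ℤ._*_ (z ℤ.+ w)) (sym (ℤP.pos-* n n))))))
  where
  factor : ∀ z w c → (z ℤ.* c ℤ.+ w ℤ.* c) ℤ.* c ≡ (z ℤ.+ w) ℤ.* (c ℤ.* c)
  factor = ℤ-Solver.solve-∀

floor-lower : ∀ x → floor x ℤ.* ↧ x ℤ.≤ ↥ x
floor-lower (mkℚ n d _) =
  subst (λ q → q ℤ.* + suc d ℤ.≤ n) (sym (ℤD.div-pos-is-/ℕ n (suc d))) (ℤD.[n/ℕd]*d≤n n (suc d))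

floor-upper : ∀ x → ↥ x ℤ.< ℤ.suc (floor x) ℤ.* ↧ x
floor-upper (mkℚ n d _) =
  subst (λ q → n ℤ.< ℤ.suc q ℤ.* + suc d) (sym (ℤD.div-pos-is-/ℕ n (suc d))) (ℤD.n<s[n/ℕd]*d n (suc d))

floor-unique : ∀ x k → k ℤ.* ↧ x ℤ.≤ ↥ x → ↥ x ℤ.< ℤ.suc k ℤ.* ↧ x → floor x ≡ k
floor-unique x@(mkℚ _ _ _) k lo hi =
  ℤP.≤-antisym (bounded-quotients (floor-lower x) hi) (bounded-quotients lo (floor-upper x))
  where
  bounded-quotients : ∀ {d n k l} .{{_ : ℤ.NonNegative d}} →
                      k ℤ.* d ℤ.≤ n → n ℤ.< ℤ.suc l ℤ.* d → k ℤ.≤ l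
  bounded-quotients {d} {k = k} {l} lo hi = subst (k ℤ.≤_) (ℤP.pred-suc l)
    (ℤP.i<j⇒i≤pred[j] {k} {ℤ.suc l} (ℤP.*-cancelʳ-<-nonNeg d (ℤP.≤-<-trans lo hi)))

gcd-positive : ∀ z n .{{_ : NonZero n}} → ℤ.Positive (ℤGCD.gcd z (+ n))
gcd-positive z n with ℕGCD.gcd ℤ.∣ z ∣ n | ℕGCD.gcd[m,n]≢0 ℤ.∣ z ∣ n (inj₂ (ℕ.≢-nonZero⁻¹ n))
... | zero  | gcd≢0 = ⊥-elim (gcd≢0 refl)
... | suc _ | _     = _

-- z / n is normalised by the positive factor gcd z n, which cancels from both bounds.
floor-/ : ∀ z n .{{_ : NonZero n}} k → k ℤ.* + n ℤ.≤ z → z ℤ.< ℤ.suc k ℤ.* + n → floor (z / n) ≡ k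
floor-/ z n k lo hi = floor-unique (z / n) k
  (ℤP.*-cancelʳ-≤-pos _ _ g (subst₂ ℤ._≤_ (sym (scaled k)) (sym (ℚP.↥-/ z n)) lo))
  (ℤP.*-cancelʳ-<-nonNeg g (subst₂ ℤ._<_ (sym (ℚP.↥-/ z n)) (sym (scaled (ℤ.suc k))) hi))
  where
  g = ℤGCD.gcd z (+ n)
  instance _ = gcd-positive z n
  scaled : ∀ k → k ℤ.* ↧ (z / n) ℤ.* g ≡ k ℤ.* + n
  scaled k = trans (ℤP.*-assoc k _ g) (cong (k ℤ.*_) (ℚP.↧-/ z n))

floor-/-<1 : ∀ j n .{{_ : NonZero n}} → j ℕ.< n → floor (+ j / n) ≡ + 0
floor-/-<1 j n j<n = floor-/ (+ j) n (+ 0) (ℤ.+≤+ ℕ.z≤n)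
  (subst (+ j ℤ.<_) (sym (ℤP.*-identityˡ (+ n))) (ℤ.+<+ j<n))

floor-+ℤ : ∀ x w → floor (x ℚ.+ w / 1) ≡ floor x ℤ.+ w
floor-+ℤ x@(mkℚ n d _) w = begin
  floor (x ℚ.+ w / 1)                              ≡⟨ cong (λ y → floor (y ℚ.+ w / 1)) (ℚP.↥p/↧p≡p x) ⟨
  floor (n / suc d ℚ.+ w / 1)                      ≡⟨ cong floor (/-+-/ n w d 0) ⟩
  floor ((n ℤ.* + 1 ℤ.+ w ℤ.* D) / (suc d ℕ.* 1))
    ≡⟨ cong floor (/-cross (n ℤ.* + 1 ℤ.+ w ℤ.* D) (n ℤ.+ w ℤ.* D) (suc d ℕ.* 1) (suc d) common-denominator) ⟩
  floor ((n ℤ.+ w ℤ.* D) / suc d)                  ≡⟨ floor-/ (n ℤ.+ w ℤ.* D) (suc d) (floor x ℤ.+ w) lo hi ⟩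
  floor x ℤ.+ w                                    ∎
  where
  open ≡-Reasoning
  D = + suc d
  common-denominator : (n ℤ.* + 1 ℤ.+ w ℤ.* D) ℤ.* D ≡ (n ℤ.+ w ℤ.* D) ℤ.* + (suc d ℕ.* 1)
  common-denominator rewrite ℕP.*-identityʳ (suc d) | ℤP.*-identityʳ n = refl
  lo : (floor x ℤ.+ w) ℤ.* D ℤ.≤ n ℤ.+ w ℤ.* D
  lo = subst (ℤ._≤ n ℤ.+ w ℤ.* D) (sym (ℤP.*-distribʳ-+ D (floor x) w))
         (ℤP.+-monoˡ-≤ (w ℤ.* D) (floor-lower x))
  hi : n ℤ.+ w ℤ.* D ℤ.< ℤ.suc (floor x ℤ.+ w) ℤ.* D
  hi = subst (n ℤ.+ w ℤ.* D ℤ.<_) (sym (distrib (floor x) w D))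
         (ℤP.+-monoˡ-< (w ℤ.* D) (floor-upper x))
    where
    distrib : ∀ a b c → (+ 1 ℤ.+ (a ℤ.+ b)) ℤ.* c ≡ (+ 1 ℤ.+ a) ℤ.* c ℤ.+ b ℤ.* c
    distrib = ℤ-Solver.solve-∀

frac-+ℤ : ∀ x w → frac (x ℚ.+ w / 1) ≡ frac x
frac-+ℤ x w = begin
  x ℚ.+ w / 1 ℚ.- floor (x ℚ.+ w / 1) / 1     ≡⟨ cong (λ z → x ℚ.+ w / 1 ℚ.- z / 1) (floor-+ℤ x w) ⟩
  x ℚ.+ w / 1 ℚ.- (floor x ℤ.+ w) / 1         ≡⟨ cong (λ y → x ℚ.+ w / 1 ℚ.- y) (+-distrib-/ (floor x) w 1) ⟩
  x ℚ.+ w / 1 ℚ.- (floor x / 1 ℚ.+ w / 1)     ≡⟨ cancel x (w / 1) (floor x / 1) ⟩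
  x ℚ.- floor x / 1                           ∎
  where
  open ≡-Reasoning
  cancel : ∀ a b c → a ℚ.+ b ℚ.- (c ℚ.+ b) ≡ a ℚ.- c
  cancel = solve-∀ ℚ-ring

negOnePow-+2 : ∀ z → negOnePow (z ℤ.+ + 2) ≡ negOnePow z
negOnePow-+2 (+ n) rewrite ℕP.+-comm n 2 = refl
negOnePow-+2 -[1+ 0 ]           = refl
negOnePow-+2 -[1+ 1 ]           = refl
negOnePow-+2 -[1+ suc (suc n) ] = refl

negOnePow-+2*ℕ : ∀ z n → negOnePow (z ℤ.+ + 2 ℤ.* + n) ≡ negOnePow z
negOnePow-+2*ℕ z zero    = cong negOnePow (ℤP.+-identityʳ z)
negOnePow-+2*ℕ z (suc n) = begin
  negOnePow (z ℤ.+ + 2 ℤ.* + suc n)          ≡⟨ cong negOnePow (step z (+ n)) ⟩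
  negOnePow (z ℤ.+ + 2 ℤ.* + n ℤ.+ + 2)      ≡⟨ negOnePow-+2 (z ℤ.+ + 2 ℤ.* + n) ⟩
  negOnePow (z ℤ.+ + 2 ℤ.* + n)              ≡⟨ negOnePow-+2*ℕ z n ⟩
  negOnePow z                                ∎
  where
  open ≡-Reasoning
  step : ∀ z n → z ℤ.+ + 2 ℤ.* (+ 1 ℤ.+ n) ≡ z ℤ.+ + 2 ℤ.* n ℤ.+ + 2
  step = ℤ-Solver.solve-∀

negOnePow-+2* : ∀ z t → negOnePow (z ℤ.+ + 2 ℤ.* t) ≡ negOnePow z
negOnePow-+2* z (+ n)    = negOnePow-+2*ℕ z n
negOnePow-+2* z -[1+ n ] = sym (begin
  negOnePow z                                            ≡⟨ cong negOnePow (unshift z (+ suc n)) ⟩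
  negOnePow (z ℤ.+ + 2 ℤ.* -[1+ n ] ℤ.+ + 2 ℤ.* + suc n) ≡⟨ negOnePow-+2*ℕ (z ℤ.+ + 2 ℤ.* -[1+ n ]) (suc n) ⟩
  negOnePow (z ℤ.+ + 2 ℤ.* -[1+ n ])                     ∎)
  where
  open ≡-Reasoning
  unshift : ∀ z t → z ≡ z ℤ.+ + 2 ℤ.* (ℤ.- t) ℤ.+ + 2 ℤ.* t
  unshift = ℤ-Solver.solve-∀

negOnePow-suc : ∀ n → negOnePow (+ suc n) ≡ ℚ.- negOnePow (+ n)
negOnePow-suc zero          = refl
negOnePow-suc (suc zero)    = refl
negOnePow-suc (suc (suc n)) = negOnePow-suc n

negOnePow-+ : ∀ m n → negOnePow (+ (m ℕ.+ n)) ≡ negOnePow (+ m) ℚ.* negOnePow (+ n)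
negOnePow-+ zero    n = sym (ℚP.*-identityˡ (negOnePow (+ n)))
negOnePow-+ (suc m) n = begin
  negOnePow (+ suc (m ℕ.+ n))                ≡⟨ negOnePow-suc (m ℕ.+ n) ⟩
  ℚ.- negOnePow (+ (m ℕ.+ n))                ≡⟨ cong ℚ.-_ (negOnePow-+ m n) ⟩
  ℚ.- (negOnePow (+ m) ℚ.* negOnePow (+ n))  ≡⟨ ℚP.neg-distribˡ-* (negOnePow (+ m)) (negOnePow (+ n)) ⟩
  ℚ.- negOnePow (+ m) ℚ.* negOnePow (+ n)    ≡⟨ cong (ℚ._* negOnePow (+ n)) (negOnePow-suc m) ⟨
  negOnePow (+ suc m) ℚ.* negOnePow (+ n)    ∎
  where open ≡-Reasoning

negOnePow-*odd-+ : ∀ k m i → negOnePow (+ (m ℕ.* suc (k ℕ.+ k) ℕ.+ i)) ≡ negOnePow (+ m) ℚ.* negOnePow (+ i)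
negOnePow-*odd-+ k m i = begin
  negOnePow (+ (m ℕ.* suc (k ℕ.+ k) ℕ.+ i))          ≡⟨ cong negOnePow even-shift ⟩
  negOnePow (+ (m ℕ.+ i) ℤ.+ + 2 ℤ.* + (m ℕ.* k))    ≡⟨ negOnePow-+2* (+ (m ℕ.+ i)) (+ (m ℕ.* k)) ⟩
  negOnePow (+ (m ℕ.+ i))                            ≡⟨ negOnePow-+ m i ⟩
  negOnePow (+ m) ℚ.* negOnePow (+ i)                ∎
  where
  open ≡-Reasoning
  regroup : ∀ k m i → m ℕ.* (1 ℕ.+ (k ℕ.+ k)) ℕ.+ i ≡ (m ℕ.+ i) ℕ.+ 2 ℕ.* (m ℕ.* k)
  regroup = ℕ-Solver.solve-∀
  even-shift : + (m ℕ.* suc (k ℕ.+ k) ℕ.+ i) ≡ + (m ℕ.+ i) ℤ.+ + 2 ℤ.* + (m ℕ.* k)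
  even-shift = trans (cong +_ (regroup k m i))
    (trans (ℤP.pos-+ (m ℕ.+ i) (2 ℕ.* (m ℕ.* k))) (cong (ℤ._+_ (+ (m ℕ.+ i))) (ℤP.pos-* 2 (m ℕ.* k))))

Ebar-periodic : ∀ p x t → Ebar p (x ℚ.+ (+ 2 ℤ.* t) / 1) ≡ Ebar p x
Ebar-periodic p x t = cong₂ ℚ._*_
  (trans (cong negOnePow (floor-+ℤ x (+ 2 ℤ.* t))) (negOnePow-+2* (floor x) t))
  (cong (E p) (frac-+ℤ x (+ 2 ℤ.* t)))

Ebar1-<1 : ∀ j n .{{_ : NonZero n}} → j ℕ.< n → Ebar 1 (+ j / n) ≡ + j / n ℚ.- ½
Ebar1-<1 j n j<n = begin
  negOnePow (floor y) ℚ.* E 1 (y ℚ.- floor y / 1)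
    ≡⟨ cong (λ z → negOnePow z ℚ.* E 1 (y ℚ.- z / 1)) (floor-/-<1 j n j<n) ⟩
  1ℚ ℚ.* ((y ℚ.- 0ℚ) ℚ.* 1ℚ ℚ.- ½)
    ≡⟨ simplify y ½ ⟩
  y ℚ.- ½ ∎
  where
  open ≡-Reasoning
  y = + j / n
  simplify : ∀ y h → 1ℚ ℚ.* ((y ℚ.- 0ℚ) ℚ.* 1ℚ ℚ.- h) ≡ y ℚ.- h
  simplify = solve-∀ ℚ-ring

alternating-∑-arithmetic : ∀ k c d →
  ∑[ m < suc (k ℕ.+ k) ] (negOnePow (+ m) ℚ.* ((+ m / 1) ℚ.* c ℚ.+ d)) ≡ (+ k / 1) ℚ.* c ℚ.+ d
alternating-∑-arithmetic zero    c d = base c d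
  where
  base : ∀ c d → 1ℚ ℚ.* (0ℚ ℚ.* c ℚ.+ d) ℚ.+ 0ℚ ≡ 0ℚ ℚ.* c ℚ.+ d
  base = solve-∀ ℚ-ring
alternating-∑-arithmetic (suc k) c d = begin
  f 0 ℚ.+ (f 1 ℚ.+ ∑< (k ℕ.+ suc k) (λ m → f (2 ℕ.+ m)))
    ≡⟨ cong (λ n → f 0 ℚ.+ (f 1 ℚ.+ ∑< n (λ m → f (2 ℕ.+ m)))) (ℕP.+-suc k k) ⟩
  f 0 ℚ.+ (f 1 ℚ.+ ∑< (suc (k ℕ.+ k)) (λ m → f (2 ℕ.+ m)))
    ≡⟨ cong (λ s → f 0 ℚ.+ (f 1 ℚ.+ s))
         (trans (∑-cong (suc (k ℕ.+ k)) (λ m _ → shifted m)) (alternating-∑-arithmetic k c d′)) ⟩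
  f 0 ℚ.+ (f 1 ℚ.+ ((+ k / 1) ℚ.* c ℚ.+ d′))
    ≡⟨ collect (+ k / 1) c d ⟩
  (1ℚ ℚ.+ + k / 1) ℚ.* c ℚ.+ d
    ≡⟨ cong (λ x → x ℚ.* c ℚ.+ d) (+-distrib-/ (+ 1) (+ k) 1) ⟨
  (+ suc k / 1) ℚ.* c ℚ.+ d ∎
  where
  open ≡-Reasoning
  f : ℕ → ℚ
  f m = negOnePow (+ m) ℚ.* ((+ m / 1) ℚ.* c ℚ.+ d)
  d′ = (1ℚ ℚ.+ 1ℚ) ℚ.* c ℚ.+ d
  shift-by-2 : ∀ s x c d → s ℚ.* (((1ℚ ℚ.+ 1ℚ) ℚ.+ x) ℚ.* c ℚ.+ d) ≡ s ℚ.* (x ℚ.* c ℚ.+ ((1ℚ ℚ.+ 1ℚ) ℚ.* c ℚ.+ d))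
  shift-by-2 = solve-∀ ℚ-ring
  shifted : ∀ m → f (2 ℕ.+ m) ≡ negOnePow (+ m) ℚ.* ((+ m / 1) ℚ.* c ℚ.+ d′)
  shifted m = trans (cong (λ x → negOnePow (+ m) ℚ.* (x ℚ.* c ℚ.+ d)) (+-distrib-/ (+ 2) (+ m) 1))
                    (shift-by-2 (negOnePow (+ m)) (+ m / 1) c d)
  collect : ∀ K c d →
    1ℚ ℚ.* (0ℚ ℚ.* c ℚ.+ d) ℚ.+ ((ℚ.- 1ℚ) ℚ.* (1ℚ ℚ.* c ℚ.+ d) ℚ.+ (K ℚ.* c ℚ.+ ((1ℚ ℚ.+ 1ℚ) ℚ.* c ℚ.+ d)))
      ≡ (1ℚ ℚ.+ K) ℚ.* c ℚ.+ d
  collect = solve-∀ ℚ-ring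

block-index-< : ∀ {q b m i} → m ℕ.< q → i ℕ.< b → m ℕ.* b ℕ.+ i ℕ.< q ℕ.* b
block-index-< {q} {b} {m} {i} m<q i<b = begin-strict
  m ℕ.* b ℕ.+ i    <⟨ ℕP.+-monoʳ-< (m ℕ.* b) i<b ⟩
  m ℕ.* b ℕ.+ b    ≡⟨ ℕP.+-comm (m ℕ.* b) b ⟩
  suc m ℕ.* b      ≤⟨ ℕP.*-monoˡ-≤ b m<q ⟩
  q ℕ.* b          ∎
  where open ℕP.≤-Reasoning

halve-by-Q : ∀ K u y → u ℚ.* (1ℚ ℚ.+ (K ℚ.+ K)) ≡ 1ℚ → K ℚ.* u ℚ.+ (u ℚ.* y ℚ.- ½) ≡ u ℚ.* (y ℚ.- ½)
halve-by-Q K u y uQ≡1 = begin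
  K ℚ.* u ℚ.+ (u ℚ.* y ℚ.- ½)
    ≡⟨ pad K u y ½ ⟩
  K ℚ.* u ℚ.* 1ℚ ℚ.+ (u ℚ.* y ℚ.- ½ ℚ.* 1ℚ)
    ≡⟨ cong₂ (λ a b → K ℚ.* u ℚ.* a ℚ.+ (u ℚ.* y ℚ.- ½ ℚ.* b)) ½+½≡1 uQ≡1 ⟨
  K ℚ.* u ℚ.* (½ ℚ.+ ½) ℚ.+ (u ℚ.* y ℚ.- ½ ℚ.* (u ℚ.* (1ℚ ℚ.+ (K ℚ.+ K))))
    ≡⟨ expand K u y ½ ⟩
  u ℚ.* (y ℚ.- ½) ∎
  where
  open ≡-Reasoning
  ½+½≡1 : ½ ℚ.+ ½ ≡ 1ℚ
  ½+½≡1 = refl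
  pad : ∀ K u y h → K ℚ.* u ℚ.+ (u ℚ.* y ℚ.- h) ≡ K ℚ.* u ℚ.* 1ℚ ℚ.+ (u ℚ.* y ℚ.- h ℚ.* 1ℚ)
  pad = solve-∀ ℚ-ring
  expand : ∀ K u y h → K ℚ.* u ℚ.* (h ℚ.+ h) ℚ.+ (u ℚ.* y ℚ.- h ℚ.* (u ℚ.* (1ℚ ℚ.+ (K ℚ.+ K)))) ≡ u ℚ.* (y ℚ.- h)
  expand = solve-∀ ℚ-ring

-- The case p = 1, x = i / b of the multiplication formula
-- Σ_{m<q} (-1)^m Ē_p((x + m)/q) = q^(-p) Ē_p(x) for odd q.
Ebar1-multiplication : ∀ k b i → i ℕ.< suc b →
  ∑[ m < suc (k ℕ.+ k) ] (negOnePow (+ m) ℚ.* Ebar 1 (+ (m ℕ.* suc b ℕ.+ i) / (suc (k ℕ.+ k) ℕ.* suc b)))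
    ≡ (+ 1 / suc (k ℕ.+ k)) ℚ.* Ebar 1 (+ i / suc b)
Ebar1-multiplication k b i i<B = begin
  ∑[ m < Q ] (negOnePow (+ m) ℚ.* Ebar 1 (+ (m ℕ.* B ℕ.+ i) / (Q ℕ.* B)))
    ≡⟨ ∑-cong Q (λ m m<Q → cong (negOnePow (+ m) ℚ.*_) (lift-value m m<Q)) ⟩
  ∑[ m < Q ] (negOnePow (+ m) ℚ.* ((+ m / 1) ℚ.* u ℚ.+ (+ i / (Q ℕ.* B) ℚ.- ½)))
    ≡⟨ alternating-∑-arithmetic k u (+ i / (Q ℕ.* B) ℚ.- ½) ⟩
  (+ k / 1) ℚ.* u ℚ.+ (+ i / (Q ℕ.* B) ℚ.- ½)
    ≡⟨ cong (λ x → (+ k / 1) ℚ.* u ℚ.+ (x ℚ.- ½)) i/QB≡u*i/B ⟩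
  (+ k / 1) ℚ.* u ℚ.+ (u ℚ.* (+ i / B) ℚ.- ½)
    ≡⟨ halve-by-Q (+ k / 1) u (+ i / B) u*Q≡1 ⟩
  u ℚ.* (+ i / B ℚ.- ½)
    ≡⟨ cong (u ℚ.*_) (Ebar1-<1 i B i<B) ⟨
  u ℚ.* Ebar 1 (+ i / B) ∎
  where
  open ≡-Reasoning
  Q = suc (k ℕ.+ k)
  B = suc b
  u = + 1 / Q
  mB/QB≡m*u : ∀ m → + (m ℕ.* B) / (Q ℕ.* B) ≡ (+ m / 1) ℚ.* u
  mB/QB≡m*u m = trans (/-crossℕ (m ℕ.* B) (m ℕ.* 1) (Q ℕ.* B) (1 ℕ.* Q) (rescale m B Q))
                      (sym (/-*-/ m 1 0 (k ℕ.+ k)))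
    where
    rescale : ∀ m B Q → m ℕ.* B ℕ.* (1 ℕ.* Q) ≡ m ℕ.* 1 ℕ.* (Q ℕ.* B)
    rescale = ℕ-Solver.solve-∀
  lift-value : ∀ m → m ℕ.< Q →
    Ebar 1 (+ (m ℕ.* B ℕ.+ i) / (Q ℕ.* B)) ≡ (+ m / 1) ℚ.* u ℚ.+ (+ i / (Q ℕ.* B) ℚ.- ½)
  lift-value m m<Q = begin
    Ebar 1 (+ (m ℕ.* B ℕ.+ i) / (Q ℕ.* B))
      ≡⟨ Ebar1-<1 (m ℕ.* B ℕ.+ i) (Q ℕ.* B) (block-index-< m<Q i<B) ⟩
    + (m ℕ.* B ℕ.+ i) / (Q ℕ.* B) ℚ.- ½
      ≡⟨ cong (λ z → z / (Q ℕ.* B) ℚ.- ½) (ℤP.pos-+ (m ℕ.* B) i) ⟩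
    (+ (m ℕ.* B) ℤ.+ + i) / (Q ℕ.* B) ℚ.- ½
      ≡⟨ cong (ℚ._- ½) (+-distrib-/ (+ (m ℕ.* B)) (+ i) (Q ℕ.* B)) ⟩
    + (m ℕ.* B) / (Q ℕ.* B) ℚ.+ + i / (Q ℕ.* B) ℚ.- ½
      ≡⟨ ℚP.+-assoc (+ (m ℕ.* B) / (Q ℕ.* B)) (+ i / (Q ℕ.* B)) (ℚ.- ½) ⟩
    + (m ℕ.* B) / (Q ℕ.* B) ℚ.+ (+ i / (Q ℕ.* B) ℚ.- ½)
      ≡⟨ cong (ℚ._+ (+ i / (Q ℕ.* B) ℚ.- ½)) (mB/QB≡m*u m) ⟩
    (+ m / 1) ℚ.* u ℚ.+ (+ i / (Q ℕ.* B) ℚ.- ½) ∎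
  i/QB≡u*i/B : + i / (Q ℕ.* B) ≡ u ℚ.* (+ i / B)
  i/QB≡u*i/B = trans (/-crossℕ i (1 ℕ.* i) (Q ℕ.* B) (Q ℕ.* B) (cong (ℕ._* (Q ℕ.* B)) (sym (ℕP.*-identityˡ i))))
                     (sym (/-*-/ 1 i (k ℕ.+ k) b))
  u*Q≡1 : u ℚ.* (1ℚ ℚ.+ (+ k / 1 ℚ.+ + k / 1)) ≡ 1ℚ
  u*Q≡1 = begin
    u ℚ.* (1ℚ ℚ.+ (+ k / 1 ℚ.+ + k / 1))  ≡⟨ cong (λ x → u ℚ.* (1ℚ ℚ.+ x)) (+-distrib-/ (+ k) (+ k) 1) ⟨
    u ℚ.* (1ℚ ℚ.+ (+ (k ℕ.+ k)) / 1)      ≡⟨ cong (u ℚ.*_) (+-distrib-/ (+ 1) (+ (k ℕ.+ k)) 1) ⟨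
    u ℚ.* (+ Q / 1)                       ≡⟨ /-*-/ 1 Q (k ℕ.+ k) 0 ⟩
    + (1 ℕ.* Q) / (Q ℕ.* 1)               ≡⟨ /-crossℕ (1 ℕ.* Q) 1 (Q ℕ.* 1) 1 (ℕP.*-assoc 1 Q 1) ⟩
    1ℚ                                    ∎

odd⇒suc[k+k] : ∀ n → ¬ 2 ND.∣ n → ∃ λ k → n ≡ suc (k ℕ.+ k)
odd⇒suc[k+k] zero          2∤n = ⊥-elim (2∤n (divides 0 refl))
odd⇒suc[k+k] (suc zero)    2∤n = 0 , refl
odd⇒suc[k+k] (suc (suc n)) 2∤n
  with odd⇒suc[k+k] n (λ { (divides t eq) → 2∤n (divides (suc t) (cong (suc ∘ suc) eq)) })
... | k , n≡1+2k = suc k , cong (suc ∘ suc) (trans n≡1+2k (sym (ℕP.+-suc k k)))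

even⇒2* : ∀ a → + 2 ZD.∣ a → ∃ λ t → a ≡ + 2 ℤ.* t
even⇒2* a 2∣a with ∣ᵤ⇒∣ 2∣a
... | divides t a≡t*2 = t , trans a≡t*2 (ℤP.*-comm t (+ 2))

-- Agrees definitionally with the local summand in the definition of T.
T-summand : ℕ → ℤ → (b : ℕ) → .{{_ : NonZero b}} → ℕ → ℚ
T-summand p a b j = negOnePow (+ j) ℚ.* Ebar p ((a ℤ.* + j) / b) ℚ.* Ebar 1 (+ j / b)

T≡∑ : ∀ p a b .{{_ : NonZero b}} → T p a b ≡ (+ 2 / 1) ℚ.* ∑[ j < b ] T-summand p a b j
T≡∑ p a b = cong ((+ 2 / 1) ℚ.*_) (sumℚ-map-applyUpTo (T-summand p a b) id b)

block-argument : ∀ a q b m i →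
  (+ suc q ℤ.* a ℤ.* + (m ℕ.* suc b ℕ.+ i)) / (suc q ℕ.* suc b) ≡ (a ℤ.* + i) / suc b ℚ.+ (a ℤ.* + m) / 1
block-argument a q b m i = sym (trans (/-+-/ (a ℤ.* + i) (a ℤ.* + m) b 0)
  (/-cross (a ℤ.* + i ℤ.* + 1 ℤ.+ a ℤ.* + m ℤ.* + B) (+ Q ℤ.* a ℤ.* + (m ℕ.* B ℕ.+ i))
           (B ℕ.* 1) (Q ℕ.* B) (sym cleared)))
  where
  Q = suc q
  B = suc b
  cross : ∀ a Q B m i → Q ℤ.* a ℤ.* (m ℤ.* B ℤ.+ i) ℤ.* (B ℤ.* + 1) ≡ (a ℤ.* i ℤ.* + 1 ℤ.+ a ℤ.* m ℤ.* B) ℤ.* (Q ℤ.* B)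
  cross = ℤ-Solver.solve-∀
  cleared : + Q ℤ.* a ℤ.* + (m ℕ.* B ℕ.+ i) ℤ.* + (B ℕ.* 1) ≡ (a ℤ.* + i ℤ.* + 1 ℤ.+ a ℤ.* + m ℤ.* + B) ℤ.* + (Q ℕ.* B)
  cleared = begin
    + Q ℤ.* a ℤ.* + (m ℕ.* B ℕ.+ i) ℤ.* + (B ℕ.* 1)
      ≡⟨ cong₂ (λ x y → + Q ℤ.* a ℤ.* x ℤ.* y)
           (trans (ℤP.pos-+ (m ℕ.* B) i) (cong (ℤ._+ + i) (ℤP.pos-* m B))) (ℤP.pos-* B 1) ⟩
    + Q ℤ.* a ℤ.* (+ m ℤ.* + B ℤ.+ + i) ℤ.* (+ B ℤ.* + 1)
      ≡⟨ cross a (+ Q) (+ B) (+ m) (+ i) ⟩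
    (a ℤ.* + i ℤ.* + 1 ℤ.+ a ℤ.* + m ℤ.* + B) ℤ.* (+ Q ℤ.* + B)
      ≡⟨ cong (ℤ._*_ (a ℤ.* + i ℤ.* + 1 ℤ.+ a ℤ.* + m ℤ.* + B)) (ℤP.pos-* Q B) ⟨
    (a ℤ.* + i ℤ.* + 1 ℤ.+ a ℤ.* + m ℤ.* + B) ℤ.* + (Q ℕ.* B) ∎
    where open ≡-Reasoning

*-left-comm : ∀ x y z → x ℚ.* (y ℚ.* z) ≡ y ℚ.* (x ℚ.* z)
*-left-comm = solve-∀ ℚ-ring

module _ (p : ℕ) (t : ℤ) (kq kb : ℕ) where

  private
    Q = suc (kq ℕ.+ kq)
    B = suc (kb ℕ.+ kb)
    A = + 2 ℤ.* t
    u = + 1 / Q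

  T-block : ∀ i → i ℕ.< B → ∑[ m < Q ] T-summand p (+ Q ℤ.* A) (Q ℕ.* B) (m ℕ.* B ℕ.+ i) ≡ u ℚ.* T-summand p A B i
  T-block i i<B = begin
    ∑[ m < Q ] T-summand p (+ Q ℤ.* A) (Q ℕ.* B) (m ℕ.* B ℕ.+ i)
      ≡⟨ ∑-cong Q (λ m _ → factor m) ⟩
    ∑[ m < Q ] (X ℚ.* lift m)
      ≡⟨ ∑-distribˡ Q X lift ⟩
    X ℚ.* ∑[ m < Q ] lift m
      ≡⟨ cong (X ℚ.*_) (Ebar1-multiplication kq (kb ℕ.+ kb) i i<B) ⟩
    X ℚ.* (u ℚ.* Ebar 1 (+ i / B))
      ≡⟨ *-left-comm X u (Ebar 1 (+ i / B)) ⟩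
    u ℚ.* T-summand p A B i ∎
    where
    open ≡-Reasoning
    X = negOnePow (+ i) ℚ.* Ebar p ((A ℤ.* + i) / B)
    lift : ℕ → ℚ
    lift m = negOnePow (+ m) ℚ.* Ebar 1 (+ (m ℕ.* B ℕ.+ i) / (Q ℕ.* B))
    periodic : ∀ m → Ebar p ((+ Q ℤ.* A ℤ.* + (m ℕ.* B ℕ.+ i)) / (Q ℕ.* B)) ≡ Ebar p ((A ℤ.* + i) / B)
    periodic m = begin
      Ebar p ((+ Q ℤ.* A ℤ.* + (m ℕ.* B ℕ.+ i)) / (Q ℕ.* B))
        ≡⟨ cong (Ebar p) (block-argument A (kq ℕ.+ kq) (kb ℕ.+ kb) m i) ⟩
      Ebar p ((A ℤ.* + i) / B ℚ.+ (A ℤ.* + m) / 1)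
        ≡⟨ cong (λ z → Ebar p ((A ℤ.* + i) / B ℚ.+ z / 1)) (ℤP.*-assoc (+ 2) t (+ m)) ⟩
      Ebar p ((A ℤ.* + i) / B ℚ.+ (+ 2 ℤ.* (t ℤ.* + m)) / 1)
        ≡⟨ Ebar-periodic p ((A ℤ.* + i) / B) (t ℤ.* + m) ⟩
      Ebar p ((A ℤ.* + i) / B) ∎
    rearrange : ∀ s s′ e e′ → s ℚ.* s′ ℚ.* e ℚ.* e′ ≡ s′ ℚ.* e ℚ.* (s ℚ.* e′)
    rearrange = solve-∀ ℚ-ring
    factor : ∀ m → T-summand p (+ Q ℤ.* A) (Q ℕ.* B) (m ℕ.* B ℕ.+ i) ≡ X ℚ.* lift m
    factor m = trans (cong₂ (λ s e → s ℚ.* e ℚ.* Ebar 1 (+ (m ℕ.* B ℕ.+ i) / (Q ℕ.* B)))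
                            (negOnePow-*odd-+ kb m i) (periodic m))
                     (rearrange (negOnePow (+ m)) (negOnePow (+ i)) (Ebar p ((A ℤ.* + i) / B)) _)

  T-scaling : T p (+ Q ℤ.* A) (Q ℕ.* B) ≡ u ℚ.* T p A B
  T-scaling = begin
    T p (+ Q ℤ.* A) (Q ℕ.* B)                              ≡⟨ T≡∑ p (+ Q ℤ.* A) (Q ℕ.* B) ⟩
    two ℚ.* ∑[ j < Q ℕ.* B ] summand j                     ≡⟨ cong (two ℚ.*_) (∑-* Q B summand) ⟩
    two ℚ.* ∑[ m < Q ] ∑[ i < B ] summand (m ℕ.* B ℕ.+ i)  ≡⟨ cong (two ℚ.*_) (∑-comm Q B (λ m i → summand (m ℕ.* B ℕ.+ i))) ⟩
    two ℚ.* ∑[ i < B ] ∑[ m < Q ] summand (m ℕ.* B ℕ.+ i)  ≡⟨ cong (two ℚ.*_) (∑-cong B T-block) ⟩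
    two ℚ.* ∑[ i < B ] (u ℚ.* T-summand p A B i)           ≡⟨ cong (two ℚ.*_) (∑-distribˡ B u (T-summand p A B)) ⟩
    two ℚ.* (u ℚ.* ∑[ i < B ] T-summand p A B i)           ≡⟨ *-left-comm two u _ ⟩
    u ℚ.* (two ℚ.* ∑[ i < B ] T-summand p A B i)           ≡⟨ cong (u ℚ.*_) (T≡∑ p A B) ⟨
    u ℚ.* T p A B                                          ∎
    where
    open ≡-Reasoning
    two = + 2 / 1
    summand = T-summand p (+ Q ℤ.* A) (Q ℕ.* B)

proposition2p3 : (a : ℤ) (b q : ℕ) .{{_ : NonZero b}} .{{_ : NonZero q}} →
    (+ 2) ZD.∣ a → ¬ (2 ND.∣ b) → ¬ (2 ND.∣ q) → (p : ℕ) →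
    T p (+ q ℤ.* a) (q Data.Nat.* b) {{m*n≢0 q b}} ≡ ((+ 1) / q) ℚ.* T p a b
proposition2p3 a b q 2∣a 2∤b 2∤q p with even⇒2* a 2∣a | odd⇒suc[k+k] b 2∤b | odd⇒suc[k+k] q 2∤q
... | t , refl | kb , refl | kq , refl = T-scaling p t kq kb
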